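{- If $\alpha$ is an MVP parking function of length $n$ with $\mathcal{O}_{\mathrm{MVP}_n}(\alpha)=(n,n-1,\dots,2,1)$, then for every $i\in[n]$, among the first $i$ steps $\phi(1),\dots,\phi(i)$ of the lattice path $\Phi(\alpha)$ there are at least as many $U$ steps as $D$ steps.
   Context: Spots $1,\dots,n$ on a one-way street; cars $1,\dots,n$ arrive in order with preferences $\alpha=(a_1,\dots,a_n)\in[n]^n$. MVP parking rule: when car $i$ arrives, if spot $a_i$ is unoccupied, car $i$ parks there; if spot $a_i$ is occupied by an earlier car $j$, then car $i$ parks in spot $a_i$ and car $j$ is bumped and parks in the first unoccupied spot among $a_i+1,\dots,n$, if any (otherwise car $j$ fails to park); a bumped car never bumps another car. $\alpha$ is an MVP parking function if all cars park; its outcome $\mathcal{O}_{\mathrm{MVP}_n}(\alpha)$ is the permutation (in one-line notation) whose $j$th entry is the car parked in spot $j$. For $v=(v_1,\dots,v_n)\in[n]^n$, $\Phi(v)=\phi(1)\phi(2)\cdots\phi(n)$ is the lattice path starting at $(0,0)$ where, for each $j\in[n]$, $\phi(j)=D$ (step $(1,-1)$) if no $i$ has $v_i=j$, $\phi(j)=H$ (step $(1,0)$) if exactly one $i$ has $v_i=j$, and $\phi(j)=U$ (step $(1,1)$) if at least two $i$ have $v_i=j$. -}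

module Defs where

open import Data.Nat using (ℕ; zero; suc)
open import Data.Fin using (Fin; toℕ)
open import Data.Vec using (Vec; toList)
open import Data.List using (List; []; _∷_; map; length; filter; take)
open import Data.Maybe using (Maybe; just; nothing)
import Data.Maybe as M
open import Data.Nat using (_≟_)
open import Relation.Nullary using (yes; no)

-- Conventions: spot k ∈ [n] is represented by the 0-based index k-1 (Fin n /
-- ℕ position in a list of length n).  Cars are numbered 1,…,n (as ℕ).
-- A street state is a list of length n; entry p is 'just c' if car c is in
-- spot p+1, 'nothing' if the spot is free.

Street : Set
Street = List (Maybe ℕ)

emptyStreet : ℕ → Street
emptyStreet zero = []
emptyStreet (suc n) = nothing ∷ emptyStreet n

lookupS : Street → ℕ → Maybe ℕ
lookupS [] _ = nothing
lookupS (x ∷ xs) zero = x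
lookupS (x ∷ xs) (suc k) = lookupS xs k

setS : Street → ℕ → Maybe ℕ → Street
setS [] _ _ = []
setS (x ∷ xs) zero y = y ∷ xs
setS (x ∷ xs) (suc k) y = x ∷ setS xs k y

placeFirst : ℕ → Street → Maybe Street
placeFirst j [] = nothing
placeFirst j (nothing ∷ xs) = just (just j ∷ xs)
placeFirst j (just c ∷ xs) = M.map (just c ∷_) (placeFirst j xs)

placeFrom : ℕ → ℕ → Street → Maybe Street
placeFrom zero j xs = placeFirst j xs
placeFrom (suc k) j [] = nothing
placeFrom (suc k) j (x ∷ xs) = M.map (x ∷_) (placeFrom k j xs)

mvpStep : ℕ → ℕ → Street → Maybe Street
mvpStep i a st with lookupS st a
... | nothing = just (setS st a (just i))
... | just j  = placeFrom (suc a) j (setS st a (just i))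

mvpRun : ℕ → List ℕ → Street → Maybe Street
mvpRun i [] st = just st
mvpRun i (a ∷ as) st with mvpStep i a st
... | nothing  = nothing
... | just st' = mvpRun (suc i) as st'

-- Result of MVP parking for α (0-based preferences): 'just s' iff every car
-- parks (α is an MVP parking function); then s lists the car in each spot.
mvp : ∀ {n} → Vec (Fin n) n → Maybe Street
mvp {n} α = mvpRun 1 (map toℕ (toList α)) (emptyStreet n)

decreasing : ℕ → List ℕ
decreasing zero = []
decreasing (suc n) = suc n ∷ decreasing n

MVPOutcomeReversed : ∀ {n} → Vec (Fin n) n → Set
MVPOutcomeReversed {n} α = mvp α ≡ just (map just (decreasing n))
  where open import Relation.Binary.PropositionalEquality using (_≡_)

data Step : Set where
  U H D : Step

occ : ∀ {n} → Vec (Fin n) n → ℕ → ℕ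
occ v j = length (filter (λ a → toℕ a ≟ j) (toList v))

stepOf : ℕ → Step
stepOf zero = D
stepOf (suc zero) = H
stepOf (suc (suc _)) = U

upToN : ℕ → List ℕ
upToN zero = []
upToN (suc n) = upToN n Data.List.++ (n ∷ [])

Φ : ∀ {n} → Vec (Fin n) n → List Step
Φ {n} v = map (λ j → stepOf (occ v j)) (upToN n)


countU : List Step → ℕ
countU [] = 0
countU (U ∷ s) = suc (countU s)
countU (H ∷ s) = countU s
countU (D ∷ s) = countU s

countD : List Step → ℕ
countD [] = 0
countD (D ∷ s) = suc (countD s)
countD (H ∷ s) = countD s
countD (U ∷ s) = countD s

-- In the outcome (n, …, 1) car k ends in spot n+1−k, and cars only ever move
-- to the right, so a_k ≤ n+1−k: the last i cars all prefer one of the first i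
-- spots.  No spot p is preferred three times: if cars x < y < z prefer p, then
-- when z arrives p holds some car w ≥ y, which is bumped to the first free spot
-- q > p, while x sits in some spot r with p < r < q (a spot that is free at the
-- end was free throughout, so x never jumped over q); later cars prefer spots
-- left of p, so x and w stay put, and r < q with x < w contradicts the
-- decreasing outcome.  Hence spot j contributes 1 − #{k : a_k = j} to #D − #U,
-- and summing over the first i spots gives #D − #U = i − #{k : a_k ≤ i} ≤ 0.

module Submission where

open import Defs
open import Data.Nat using (ℕ; zero; suc; _+_; _∸_; _≤_; _<_; z≤n; s≤s; _≟_; _<?_; _≤?_)
open import Data.Nat.Properties
open import Data.Fin using (Fin; toℕ)
open import Data.Fin.Properties using (toℕ<n)
open import Data.Vec using (Vec; toList)
open import Data.Vec.Properties using (length-toList)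
open import Data.List using (List; []; _∷_; _++_; length; map; filter; take; drop)
open import Data.Nat.ListAction using (sum)
open import Data.Nat.ListAction.Properties using (sum-++)
open import Data.List.Properties
  using (length-++; length-map; map-++; map-∘; ++-assoc; filter-++; filter-all; filter-none; filter-accept; filter-reject;
         take-map; take-all; take++drop≡id; length-take; length-drop; map-cong)
open import Data.List.Relation.Unary.All as All using (All; []; _∷_)
open import Data.List.Relation.Unary.All.Properties using (map⁺)
open import Data.Maybe using (just; nothing)
open import Data.Maybe.Properties using (just-injective)
open import Data.Product using (∃; ∃₂; _×_; _,_)
open import Data.Sum using (inj₁; inj₂)
open import Data.Bool using (true; false)
open import Data.Empty using (⊥; ⊥-elim)
open import Function using (_∘_)
open import Relation.Nullary using (¬_; does; yes; no)
open import Relation.Unary using (Pred; Decidable)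
open import Relation.Binary.Definitions using (tri<; tri≈; tri>)
open import Relation.Binary.PropositionalEquality

private
  variable
    i a n p q r s x : ℕ
    as bs : List ℕ
    S S' F : Street

count : ∀ {a ℓ} {A : Set a} {P : Pred A ℓ} → Decidable P → List A → ℕ
count P? = length ∘ filter P?

module _ {a ℓ} {A : Set a} {P : Pred A ℓ} (P? : Decidable P) where

  count-++ : ∀ xs ys → count P? (xs ++ ys) ≡ count P? xs + count P? ys
  count-++ xs ys = trans (cong length (filter-++ P? xs ys)) (length-++ (filter P? xs))

  count-all : ∀ {xs} → All P xs → count P? xs ≡ length xs
  count-all = cong length ∘ filter-all P?

  none⇒count≡0 : ∀ {xs} → All (¬_ ∘ P) xs → count P? xs ≡ 0
  none⇒count≡0 = cong length ∘ filter-none P?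

  count≡0⇒none : ∀ xs → count P? xs ≡ 0 → All (¬_ ∘ P) xs
  count≡0⇒none []       _ = []
  count≡0⇒none (x ∷ xs) h with P? x
  ... | no ¬px = ¬px ∷ count≡0⇒none xs h

  count-accept : ∀ {x xs} → P x → count P? (x ∷ xs) ≡ suc (count P? xs)
  count-accept = cong length ∘ filter-accept P?

  count-reject : ∀ {x xs} → ¬ P x → count P? (x ∷ xs) ≡ count P? xs
  count-reject = cong length ∘ filter-reject P?

  count-map : ∀ {b} {B : Set b} (f : B → A) xs → count P? (map f xs) ≡ count (P? ∘ f) xs
  count-map f []       = refl
  count-map f (x ∷ xs) with does (P? (f x))
  ... | true  = cong suc (count-map f xs)
  ... | false = count-map f xs

count-<-suc : ∀ i xs → count (_<? suc i) xs ≡ count (_<? i) xs + count (_≟ i) xs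
count-<-suc i []       = refl
count-<-suc i (x ∷ xs) with <-cmp x i
... | tri< x<i x≢i _ = begin
  count (_<? suc i) (x ∷ xs)                      ≡⟨ count-accept (_<? suc i) (m<n⇒m<1+n x<i) ⟩
  suc (count (_<? suc i) xs)                      ≡⟨ cong suc (count-<-suc i xs) ⟩
  suc (count (_<? i) xs) + count (_≟ i) xs        ≡⟨ cong₂ _+_ (count-accept (_<? i) x<i) (count-reject (_≟ i) x≢i) ⟨
  count (_<? i) (x ∷ xs) + count (_≟ i) (x ∷ xs)  ∎
  where open ≡-Reasoning
... | tri≈ x≮i refl _ = begin
  count (_<? suc x) (x ∷ xs)                      ≡⟨ count-accept (_<? suc x) (n<1+n x) ⟩
  suc (count (_<? suc x) xs)                      ≡⟨ cong suc (count-<-suc x xs) ⟩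
  suc (count (_<? x) xs + count (_≟ x) xs)        ≡⟨ +-suc _ _ ⟨
  count (_<? x) xs + suc (count (_≟ x) xs)        ≡⟨ cong₂ _+_ (count-reject (_<? x) x≮i) (count-accept (_≟ x) refl) ⟨
  count (_<? x) (x ∷ xs) + count (_≟ x) (x ∷ xs)  ∎
  where open ≡-Reasoning
... | tri> x≮i x≢i i<x = begin
  count (_<? suc i) (x ∷ xs)                      ≡⟨ count-reject (_<? suc i) (<⇒≱ i<x ∘ ≤-pred) ⟩
  count (_<? suc i) xs                            ≡⟨ count-<-suc i xs ⟩
  count (_<? i) xs + count (_≟ i) xs              ≡⟨ cong₂ _+_ (count-reject (_<? i) x≮i) (count-reject (_≟ i) x≢i) ⟨
  count (_<? i) (x ∷ xs) + count (_≟ i) (x ∷ xs)  ∎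
  where open ≡-Reasoning

sum-counts : ∀ i xs → sum (map (λ j → count (_≟ j) xs) (upToN i)) ≡ count (_<? i) xs
sum-counts zero    xs = sym (cong length (filter-none (_<? 0) (All.universal (λ _ ()) xs)))
sum-counts (suc i) xs = begin
  sum (map occurrences (upToN i ++ i ∷ []))               ≡⟨ cong sum (map-++ occurrences (upToN i) (i ∷ [])) ⟩
  sum (map occurrences (upToN i) ++ occurrences i ∷ [])   ≡⟨ sum-++ (map occurrences (upToN i)) (occurrences i ∷ []) ⟩
  sum (map occurrences (upToN i)) + (occurrences i + 0)   ≡⟨ cong₂ _+_ (sum-counts i xs) (+-identityʳ _) ⟩
  count (_<? i) xs + count (_≟ i) xs                      ≡⟨ count-<-suc i xs ⟨
  count (_<? suc i) xs                                    ∎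
  where
  open ≡-Reasoning
  occurrences : ℕ → ℕ
  occurrences j = count (_≟ j) xs

last-occurrence : ∀ p xs → 1 ≤ count (_≟ p) xs → ∃₂ λ A Z → xs ≡ A ++ p ∷ Z × All (_≢ p) Z
last-occurrence p (a ∷ xs) h with 1 ≤? count (_≟ p) xs
... | yes h′ = let A , Z , e , Z≢p = last-occurrence p xs h′ in a ∷ A , Z , cong (a ∷_) e , Z≢p
... | no h′ with a ≟ p
...   | yes refl = [] , xs , refl , count≡0⇒none (_≟ p) xs (n<1⇒n≡0 (≰⇒> h′))
...   | no a≢p   = ⊥-elim (h′ (subst (1 ≤_) (count-reject (_≟ p) a≢p) h))

count-last : ∀ A Z → All (_≢ p) Z → count (_≟ p) (A ++ p ∷ Z) ≡ suc (count (_≟ p) A)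
count-last {p} A Z Z≢p = begin
  count (_≟ p) (A ++ p ∷ Z)                 ≡⟨ count-++ (_≟ p) A (p ∷ Z) ⟩
  count (_≟ p) A + count (_≟ p) (p ∷ Z)     ≡⟨ cong (count (_≟ p) A +_) p∷Z-once ⟩
  count (_≟ p) A + 1                        ≡⟨ +-comm _ 1 ⟩
  suc (count (_≟ p) A)                      ∎
  where
  open ≡-Reasoning
  p∷Z-once : count (_≟ p) (p ∷ Z) ≡ 1
  p∷Z-once = trans (count-accept (_≟ p) refl) (cong suc (none⇒count≡0 (_≟ p) Z≢p))

three-occurrences : ∀ p xs → 3 ≤ count (_≟ p) xs →
                    ∃₂ λ A B → ∃₂ λ C Z → xs ≡ A ++ p ∷ (B ++ p ∷ C) ++ p ∷ Z × All (_≢ p) Z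
three-occurrences p xs 3≤xs
  with X , Z , refl , Z≢p ← last-occurrence p xs (≤-trans (s≤s z≤n) 3≤xs)
  with 2≤X                ← ≤-pred (subst (3 ≤_) (count-last X Z Z≢p) 3≤xs)
  with Y , C , refl , C≢p ← last-occurrence p X (≤-trans (s≤s z≤n) 2≤X)
  with A , B , refl , _   ← last-occurrence p Y (≤-pred (subst (2 ≤_) (count-last Y C C≢p) 2≤X))
  = A , B , C , Z , reassociate , Z≢p
  where
  open ≡-Reasoning
  reassociate : ((A ++ p ∷ B) ++ p ∷ C) ++ p ∷ Z ≡ A ++ p ∷ (B ++ p ∷ C) ++ p ∷ Z
  reassociate = begin
    ((A ++ p ∷ B) ++ p ∷ C) ++ p ∷ Z ≡⟨ cong (_++ p ∷ Z) (++-assoc A (p ∷ B) (p ∷ C)) ⟩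
    (A ++ p ∷ B ++ p ∷ C) ++ p ∷ Z   ≡⟨ ++-assoc A (p ∷ B ++ p ∷ C) (p ∷ Z) ⟩
    A ++ p ∷ (B ++ p ∷ C) ++ p ∷ Z   ∎

take-++ˡ : ∀ {A : Set} i (xs ys : List A) → i ≤ length xs → take i (xs ++ ys) ≡ take i xs
take-++ˡ zero    xs       ys _         = refl
take-++ˡ (suc i) (x ∷ xs) ys (s≤s i≤l) = cong (x ∷_) (take-++ˡ i xs ys i≤l)

path-balance : ∀ os → All (_≤ 2) os → countD (map stepOf os) + sum os ≡ length os + countU (map stepOf os)
path-balance []                       []      = refl
path-balance (zero ∷ os)              (_ ∷ h) = cong suc (path-balance os h)
path-balance (suc zero ∷ os)          (_ ∷ h) = trans (+-suc _ _) (cong suc (path-balance os h))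
path-balance (suc (suc zero) ∷ os)    (_ ∷ h) =
  trans (+-suc _ _) (trans (cong suc (+-suc _ _)) (trans (cong (suc ∘ suc) (path-balance os h)) (cong suc (sym (+-suc _ _)))))
path-balance (suc (suc (suc _)) ∷ _) (s≤s (s≤s ()) ∷ _)

countD≤countU : ∀ os → All (_≤ 2) os → length os ≤ sum os → countD (map stepOf os) ≤ countU (map stepOf os)
countD≤countU os os≤2 len≤sum = +-cancelʳ-≤ (sum os) _ _ (begin
  countD (map stepOf os) + sum os    ≡⟨ path-balance os os≤2 ⟩
  length os + countU (map stepOf os) ≤⟨ +-monoˡ-≤ _ len≤sum ⟩
  sum os + countU (map stepOf os)    ≡⟨ +-comm (sum os) _ ⟩
  countU (map stepOf os) + sum os    ∎)
  where open ≤-Reasoning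

length-upToN : ∀ n → length (upToN n) ≡ n
length-upToN zero    = refl
length-upToN (suc n) = trans (length-++ (upToN n)) (trans (cong (_+ 1) (length-upToN n)) (+-comm n 1))

take-upToN : ∀ i n → i ≤ n → take i (upToN n) ≡ upToN i
take-upToN i zero    z≤n = refl
take-upToN i (suc n) i≤1+n with m≤n⇒m<n∨m≡n i≤1+n
... | inj₁ i<1+n = trans (take-++ˡ i (upToN n) (n ∷ []) (subst (i ≤_) (sym (length-upToN n)) (≤-pred i<1+n)))
                         (take-upToN i n (≤-pred i<1+n))
... | inj₂ refl  = take-all (suc n) (upToN (suc n)) (≤-reflexive (length-upToN (suc n)))

take-Φ : ∀ {n i} (α : Vec (Fin n) n) → i ≤ n → take i (Φ α) ≡ map stepOf (map (occ α) (upToN i))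
take-Φ {n} {i} α i≤n = begin
  take i (map (stepOf ∘ occ α) (upToN n)) ≡⟨ take-map i (upToN n) ⟩
  map (stepOf ∘ occ α) (take i (upToN n)) ≡⟨ cong (map (stepOf ∘ occ α)) (take-upToN i n i≤n) ⟩
  map (stepOf ∘ occ α) (upToN i)          ≡⟨ map-∘ (upToN i) ⟩
  map stepOf (map (occ α) (upToN i))      ∎
  where open ≡-Reasoning

length-emptyStreet : ∀ n → length (emptyStreet n) ≡ n
length-emptyStreet zero    = refl
length-emptyStreet (suc n) = cong suc (length-emptyStreet n)

length-setS : ∀ S a v → length (setS S a v) ≡ length S
length-setS []      a       v = refl
length-setS (_ ∷ S) zero    v = refl
length-setS (_ ∷ S) (suc a) v = cong suc (length-setS S a v)

lookupS-setS-≡ : ∀ S a v → a < length S → lookupS (setS S a v) a ≡ v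
lookupS-setS-≡ (_ ∷ S) zero    v _         = refl
lookupS-setS-≡ (_ ∷ S) (suc a) v (s≤s a<l) = lookupS-setS-≡ S a v a<l

lookupS-setS-≢ : ∀ S a v s → s ≢ a → lookupS (setS S a v) s ≡ lookupS S s
lookupS-setS-≢ []      a       v s       s≢a = refl
lookupS-setS-≢ (_ ∷ S) zero    v zero    s≢a = ⊥-elim (s≢a refl)
lookupS-setS-≢ (_ ∷ S) zero    v (suc s) s≢a = refl
lookupS-setS-≢ (_ ∷ S) (suc a) v zero    s≢a = refl
lookupS-setS-≢ (_ ∷ S) (suc a) v (suc s) s≢a = lookupS-setS-≢ S a v s (s≢a ∘ cong suc)

lookupS-just⇒< : ∀ S s {x} → lookupS S s ≡ just x → s < length S
lookupS-just⇒< (_ ∷ S) zero    _ = s≤s z≤n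
lookupS-just⇒< (_ ∷ S) (suc s) e = s≤s (lookupS-just⇒< S s e)

just≢nothing : just x ≢ nothing
just≢nothing ()

record ParkedFirstFree (k j : ℕ) (S S' : Street) : Set where
  field
    spot            : ℕ
    k≤spot          : k ≤ spot
    spot<length     : spot < length S
    spot-free       : lookupS S spot ≡ nothing
    no-free-between : ∀ s → k ≤ s → s < spot → lookupS S s ≢ nothing
    result          : S' ≡ setS S spot (just j)

placeFirst-spec : ∀ j S → placeFirst j S ≡ just S' → ParkedFirstFree 0 j S S'
placeFirst-spec j (nothing ∷ S) refl = record
  { spot = 0 ; k≤spot = z≤n ; spot<length = s≤s z≤n ; spot-free = refl
  ; no-free-between = λ _ _ () ; result = refl }
placeFirst-spec j (just c ∷ S) e with placeFirst j S in e₁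
placeFirst-spec j (just c ∷ S) refl | just T = record
  { spot = suc spot ; k≤spot = z≤n ; spot<length = s≤s spot<length ; spot-free = spot-free
  ; no-free-between = λ { zero _ _ () ; (suc s) _ (s≤s s<spot) → no-free-between s z≤n s<spot }
  ; result = cong (just c ∷_) result }
  where open ParkedFirstFree (placeFirst-spec j S e₁)

placeFrom-spec : ∀ k j S → placeFrom k j S ≡ just S' → ParkedFirstFree k j S S'
placeFrom-spec zero    j S       e = placeFirst-spec j S e
placeFrom-spec (suc k) j (c ∷ S) e with placeFrom k j S in e₁
placeFrom-spec (suc k) j (c ∷ S) refl | just T = record
  { spot = suc spot ; k≤spot = s≤s k≤spot ; spot<length = s≤s spot<length ; spot-free = spot-free
  ; no-free-between = λ { zero () ; (suc s) (s≤s k≤s) (s≤s s<spot) → no-free-between s k≤s s<spot }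
  ; result = cong (c ∷_) result }
  where open ParkedFirstFree (placeFrom-spec k j S e₁)

data MVPStep (i a : ℕ) (S S' : Street) : Set where
  parks : lookupS S a ≡ nothing → S' ≡ setS S a (just i) → MVPStep i a S S'
  bumps : ∀ j → lookupS S a ≡ just j →
          ParkedFirstFree (suc a) j (setS S a (just i)) S' → MVPStep i a S S'

mvpStep-view : ∀ i a S → mvpStep i a S ≡ just S' → MVPStep i a S S'
mvpStep-view i a S e with lookupS S a in e₁
... | nothing = parks e₁ (sym (just-injective e))
... | just j  = bumps j e₁ (placeFrom-spec (suc a) j (setS S a (just i)) e)

step-length : MVPStep i a S S' → length S' ≡ length S
step-length {i} {a} {S} (parks _ refl) = length-setS S a (just i)
step-length {i} {a} {S} {S'} (bumps j _ placed) = begin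
  length S'                                       ≡⟨ cong length result ⟩
  length (setS (setS S a (just i)) spot (just j)) ≡⟨ length-setS (setS S a (just i)) spot (just j) ⟩
  length (setS S a (just i))                      ≡⟨ length-setS S a (just i) ⟩
  length S                                        ∎
  where open ParkedFirstFree placed
        open ≡-Reasoning

step-parks-at-pref : MVPStep i a S S' → a < length S → lookupS S' a ≡ just i
step-parks-at-pref {i} {a} {S} (parks _ refl) a<l = lookupS-setS-≡ S a (just i) a<l
step-parks-at-pref {i} {a} {S} {S'} (bumps j _ placed) a<l = begin
  lookupS S' a                                       ≡⟨ cong (λ T → lookupS T a) result ⟩
  lookupS (setS (setS S a (just i)) spot (just j)) a ≡⟨ lookupS-setS-≢ (setS S a (just i)) spot (just j) a (<⇒≢ k≤spot) ⟩
  lookupS (setS S a (just i)) a                      ≡⟨ lookupS-setS-≡ S a (just i) a<l ⟩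
  just i                                             ∎
  where open ParkedFirstFree placed
        open ≡-Reasoning

step-keeps : MVPStep i a S S' → s ≢ a → lookupS S s ≡ just x → lookupS S' s ≡ just x
step-keeps {i} {a} {S} {s = s} (parks _ refl) s≢a Ss = trans (lookupS-setS-≢ S a (just i) s s≢a) Ss
step-keeps {i} {a} {S} {S'} {s} {x} (bumps j _ placed) s≢a Ss = begin
  lookupS S' s                                       ≡⟨ cong (λ T → lookupS T s) result ⟩
  lookupS (setS (setS S a (just i)) spot (just j)) s ≡⟨ lookupS-setS-≢ (setS S a (just i)) spot (just j) s s≢spot ⟩
  lookupS (setS S a (just i)) s                      ≡⟨ s-holds-x ⟩
  just x                                             ∎
  where
  open ParkedFirstFree placed
  open ≡-Reasoning
  s-holds-x : lookupS (setS S a (just i)) s ≡ just x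
  s-holds-x = trans (lookupS-setS-≢ S a (just i) s s≢a) Ss
  s≢spot : s ≢ spot
  s≢spot refl = just≢nothing (trans (sym s-holds-x) spot-free)

record BumpedTo (a x : ℕ) (S S' : Street) : Set where
  field
    spot            : ℕ
    a<spot          : a < spot
    was-free        : lookupS S spot ≡ nothing
    now-x           : lookupS S' spot ≡ just x
    no-free-between : ∀ s → a < s → s < spot → lookupS S s ≢ nothing

step-bumps : MVPStep i a S S' → lookupS S a ≡ just x → BumpedTo a x S S'
step-bumps (parks Sa _) Sa′ with () ← trans (sym Sa′) Sa
step-bumps {i} {a} {S} (bumps j Sa placed) Sa′ with refl ← trans (sym Sa′) Sa = record
  { spot = spot ; a<spot = k≤spot
  ; was-free = trans (sym (lookupS-setS-≢ S a (just i) spot (>⇒≢ k≤spot))) spot-free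
  ; now-x = trans (cong (λ T → lookupS T spot) result) (lookupS-setS-≡ (setS S a (just i)) spot (just j) spot<length)
  ; no-free-between = λ s a<s s<spot Ss →
      no-free-between s a<s s<spot (trans (lookupS-setS-≢ S a (just i) s (>⇒≢ a<s)) Ss) }
  where open ParkedFirstFree placed

step-reflects-free : MVPStep i a S S' → lookupS S' s ≡ nothing → lookupS S s ≡ nothing
step-reflects-free {a = a} {S} {s = s} st S's with lookupS S s in Ss
... | nothing = refl
... | just x with s ≟ a
...   | yes refl with () ← trans (sym (step-parks-at-pref st (lookupS-just⇒< S s Ss))) S's
...   | no s≢a   with () ← trans (sym (step-keeps st s≢a Ss)) S's

data Run : ℕ → List ℕ → Street → Street → Set where
  done : Run i [] S S
  step : a < length S → MVPStep i a S S' → Run (suc i) as S' F → Run i (a ∷ as) S F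

mvpRun⇒Run : ∀ i as S → All (_< length S) as → mvpRun i as S ≡ just F → Run i as S F
mvpRun⇒Run i []       S []           refl = done
mvpRun⇒Run i (a ∷ as) S (a<l ∷ as<l) e with mvpStep i a S in e₁
... | just S' = step a<l st (mvpRun⇒Run (suc i) as S' (All.map (λ b<l → subst (_ <_) (sym (step-length st)) b<l) as<l) e)
  where st = mvpStep-view i a S e₁

Run-++⁻ : ∀ as → Run i (as ++ bs) S F → ∃ λ M → Run i as S M × Run (i + length as) bs M F
Run-++⁻ {i} {bs} {S} {F} [] run = S , done , subst (λ k → Run k bs S F) (sym (+-identityʳ i)) run
Run-++⁻ {i} {bs} {S} {F} (a ∷ as) (step a<l st run) with M , run₁ , run₂ ← Run-++⁻ as run =
  M , step a<l st run₁ , subst (λ k → Run k bs M F) (sym (+-suc i (length as))) run₂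

Run-reflects-free : Run i as S F → lookupS F s ≡ nothing → lookupS S s ≡ nothing
Run-reflects-free done            Fs = Fs
Run-reflects-free (step _ st run) Fs = step-reflects-free st (Run-reflects-free run Fs)

Run-keeps-unpreferred : Run i as S F → All (_≢ s) as → lookupS S s ≡ just x → lookupS F s ≡ just x
Run-keeps-unpreferred done            []           Ss = Ss
Run-keeps-unpreferred (step _ st run) (a≢s ∷ as≢s) Ss =
  Run-keeps-unpreferred run as≢s (step-keeps st (a≢s ∘ sym) Ss)

Run-moves-right : Run i as S F → lookupS S s ≡ just x → ∃ λ s' → s ≤ s' × lookupS F s' ≡ just x
Run-moves-right done Ss = _ , ≤-refl , Ss
Run-moves-right {s = s} (step {a = a} _ st run) Ss with s ≟ a
... | no s≢a   = Run-moves-right run (step-keeps st s≢a Ss)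
... | yes refl =
  let s' , spot≤s' , Fs' = Run-moves-right run now-x in s' , ≤-trans (<⇒≤ a<spot) spot≤s' , Fs'
  where open BumpedTo (step-bumps st Ss)

Run-confined-below-free : Run i as S F → lookupS F q ≡ nothing → lookupS S r ≡ just x → r < q →
                          ∃ λ r' → r ≤ r' × r' < q × lookupS F r' ≡ just x
Run-confined-below-free done Fq Sr r<q = _ , ≤-refl , r<q , Sr
Run-confined-below-free {q = q} {r} (step {a = a} {S' = S'} _ st run) Fq Sr r<q with r ≟ a
... | no r≢a   = Run-confined-below-free run Fq (step-keeps st r≢a Sr) r<q
... | yes refl =
  let r' , spot≤r' , r'<q , Fr' = Run-confined-below-free run Fq now-x spot<q in
  r' , ≤-trans (<⇒≤ a<spot) spot≤r' , r'<q , Fr'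
  where
  open BumpedTo (step-bumps st Sr)
  S'q : lookupS S' q ≡ nothing
  S'q = Run-reflects-free run Fq
  spot<q : spot < q
  spot<q = ≤∧≢⇒<
    (≮⇒≥ (λ q<spot → no-free-between q r<q q<spot (step-reflects-free st S'q)))
    (λ { refl → just≢nothing (trans (sym now-x) S'q) })

Run-occupant-≥ : ∀ {y w} → Run i as S F → y ≤ i → lookupS S p ≡ just w → y ≤ w →
                 ∃ λ w' → lookupS F p ≡ just w' × y ≤ w'
Run-occupant-≥ done _ Sp y≤w = _ , Sp , y≤w
Run-occupant-≥ {p = p} (step {a = a} a<l st run) y≤i Sp y≤w with p ≟ a
... | yes refl = Run-occupant-≥ run (m≤n⇒m≤1+n y≤i) (step-parks-at-pref st a<l) y≤i
... | no p≢a   = Run-occupant-≥ run (m≤n⇒m≤1+n y≤i) (step-keeps st p≢a Sp) y≤w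

Reversed : ℕ → Street → Set
Reversed n F = ∀ s x → lookupS F s ≡ just x → s + x ≡ n

decreasing-reversed : ∀ n → Reversed n (map just (decreasing n))
decreasing-reversed (suc n) zero    x refl = refl
decreasing-reversed (suc n) (suc s) x e    = cong suc (decreasing-reversed n s x e)

Run-prefs-bounded : Run i as S F → Reversed n F → All (λ a → a + i ≤ n) as
Run-prefs-bounded done _ = []
Run-prefs-bounded {i} (step {a = a} a<l st run) rev =
  let s' , a≤s' , Fs' = Run-moves-right run (step-parks-at-pref st a<l) in
  ≤-trans (+-monoˡ-≤ i a≤s') (≤-reflexive (rev s' i Fs'))
  ∷ All.map (≤-trans (+-monoʳ-≤ _ (n≤1+n i))) (Run-prefs-bounded run rev)

Run-prefs-left-of : ∀ {z p} → Run (suc z) as S F → Reversed n F → lookupS F p ≡ just z → All (_< p) as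
Run-prefs-left-of {n = n} {z} {p} run rev Fp = All.map below-p (Run-prefs-bounded run rev)
  where
  below-p : ∀ {a} → a + suc z ≤ n → a < p
  below-p {a} bound = +-cancelʳ-≤ z (suc a) p (subst₂ _≤_ (+-suc a z) (sym (rev p z Fp)) bound)

Reversed-antitone : ∀ {w} → Reversed n F → lookupS F r ≡ just x → lookupS F q ≡ just w → r < q → w < x
Reversed-antitone {r = r} {x} {q} {w = w} rev Fr Fq r<q = ≰⇒> λ x≤w →
  <-irrefl (trans (rev r x Fr) (sym (rev q w Fq))) (+-mono-<-≤ r<q x≤w)

no-triple-preference : ∀ A B C Z → All (_≢ p) Z → Run i (A ++ p ∷ (B ++ p ∷ C) ++ p ∷ Z) S F →
                       Reversed n F → ⊥
no-triple-preference {p} {i} {F = F} A B C Z Z≢p run rev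
  with _ , _ , step lx ex runBCZ ← Run-++⁻ A run
  with _ , runBC , step lz ez runZ ← Run-++⁻ (B ++ p ∷ C) runBCZ
  with _ , _ , step ly ey runC ← Run-++⁻ B runBC
  with w , Mp , y≤w ← Run-occupant-≥ runC (n≤1+n _) (step-parks-at-pref ey ly) ≤-refl
  with record { spot = q ; a<spot = p<q ; was-free = Mq ; now-x = M′q } ← step-bumps ez Mp
  with r , p≤r , r<q , Mr ← Run-confined-below-free runBC Mq (step-parks-at-pref ex lx) p<q
  = <-asym x<w (Reversed-antitone {F = F} rev Fr Fq r<q)
  where
  x<w : i + length A < w
  x<w = <-≤-trans (m≤m+n (suc (i + length A)) (length B)) y≤w
  r≢p : r ≢ p
  r≢p refl = <-irrefl (just-injective (trans (sym Mr) Mp)) x<w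
  Z<p : All (_< p) Z
  Z<p = Run-prefs-left-of runZ rev (Run-keeps-unpreferred runZ Z≢p (step-parks-at-pref ez lz))
  Fr = Run-keeps-unpreferred runZ (All.map (λ a<p → <⇒≢ (<-≤-trans a<p p≤r)) Z<p) (step-keeps ez r≢p Mr)
  Fq = Run-keeps-unpreferred runZ (All.map (λ a<p → <⇒≢ (<-trans a<p p<q)) Z<p) M′q

prefs-at-most-two : Run i as S F → Reversed n F → ∀ p → count (_≟ p) as ≤ 2
prefs-at-most-two {as = as} run rev p with count (_≟ p) as ≤? 2
... | yes ≤2 = ≤2
... | no ≰2 with A , B , C , Z , refl , Z≢p ← three-occurrences p as (≰⇒> ≰2) =
  ⊥-elim (no-triple-preference A B C Z Z≢p run rev)

Run-last-cars-prefer-below : Run 1 as S F → Reversed n F → length as ≡ n → i ≤ n → All (_< i) (drop (n ∸ i) as)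
Run-last-cars-prefer-below {as} {n = n} {i} run rev len i≤n
  with _ , _ , run₂ ← Run-++⁻ (take (n ∸ i) as) (subst (λ l → Run 1 l _ _) (sym (take++drop≡id (n ∸ i) as)) run)
  = All.map below (Run-prefs-bounded run₂ rev)
  where
  open ≤-Reasoning
  k = n ∸ i
  length-prefix : length (take k as) ≡ k
  length-prefix = trans (length-take k as) (m≤n⇒m⊓n≡m (subst (k ≤_) (sym len) (m∸n≤m n i)))
  below : ∀ {a} → a + (1 + length (take k as)) ≤ n → a < i
  below {a} bound = +-cancelʳ-≤ k (suc a) i (begin
    suc a + k                     ≡⟨ +-suc a k ⟨
    a + suc k                     ≡⟨ cong (λ m → a + suc m) length-prefix ⟨
    a + (1 + length (take k as))  ≤⟨ bound ⟩
    n                             ≡⟨ m∸n+n≡m i≤n ⟨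
    k + i                         ≡⟨ +-comm k i ⟩
    i + k                         ∎)

Run-count-below : Run 1 as S F → Reversed n F → length as ≡ n → i ≤ n → i ≤ count (_<? i) as
Run-count-below {as} {n = n} {i} run rev len i≤n = begin
  i                                                   ≡⟨ m∸[m∸n]≡n i≤n ⟨
  n ∸ k                                               ≡⟨ trans (length-drop k as) (cong (_∸ k) len) ⟨
  length (drop k as)                                  ≡⟨ count-all (_<? i) (Run-last-cars-prefer-below run rev len i≤n) ⟨
  count (_<? i) (drop k as)                           ≤⟨ m≤n+m _ _ ⟩
  count (_<? i) (take k as) + count (_<? i) (drop k as) ≡⟨ count-++ (_<? i) (take k as) (drop k as) ⟨
  count (_<? i) (take k as ++ drop k as)              ≡⟨ cong (count (_<? i)) (take++drop≡id k as) ⟩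
  count (_<? i) as                                    ∎
  where
  open ≤-Reasoning
  k = n ∸ i

module _ {n} (α : Vec (Fin n) n) (outcome : MVPOutcomeReversed α) where

  private
    prefs : List ℕ
    prefs = map toℕ (toList α)

    run : Run 1 prefs (emptyStreet n) (map just (decreasing n))
    run = mvpRun⇒Run 1 prefs (emptyStreet n)
            (map⁺ (All.universal (λ a → subst (toℕ a <_) (sym (length-emptyStreet n)) (toℕ<n a)) (toList α)))
            outcome

    occ≡count : ∀ j → occ α j ≡ count (_≟ j) prefs
    occ≡count j = sym (count-map (_≟ j) toℕ (toList α))

  occ≤2 : ∀ j → occ α j ≤ 2
  occ≤2 j = subst (_≤ 2) (sym (occ≡count j)) (prefs-at-most-two run (decreasing-reversed n) j)

  sum-occ-≥ : ∀ {i} → i ≤ n → i ≤ sum (map (occ α) (upToN i))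
  sum-occ-≥ {i} i≤n = begin
    i                                              ≤⟨ Run-count-below run (decreasing-reversed n) length-prefs i≤n ⟩
    count (_<? i) prefs                            ≡⟨ sum-counts i prefs ⟨
    sum (map (λ j → count (_≟ j) prefs) (upToN i)) ≡⟨ cong sum (map-cong occ≡count (upToN i)) ⟨
    sum (map (occ α) (upToN i))                    ∎
    where
    open ≤-Reasoning
    length-prefs : length prefs ≡ n
    length-prefs = trans (length-map toℕ (toList α)) (length-toList α)

lemma4p6 : (n : ℕ) (α : Vec (Fin n) n) → MVPOutcomeReversed α →
    (i : ℕ) → 1 ≤ i → i ≤ n →
    countD (take i (Φ α)) ≤ countU (take i (Φ α))
lemma4p6 n α outcome i _ i≤n =
  subst (λ path → countD path ≤ countU path) (sym (take-Φ α i≤n))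
    (countD≤countU occurrences (map⁺ (All.universal (occ≤2 α outcome) (upToN i))) length≤sum)
  where
  occurrences = map (occ α) (upToN i)
  length≤sum : length occurrences ≤ sum occurrences
  length≤sum = subst (_≤ sum occurrences) (sym (trans (length-map (occ α) (upToN i)) (length-upToN i)))
                 (sum-occ-≥ α outcome i≤n)
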